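{- Consider the calculus $\beta Y=(\Lambda_Y,\to_\beta\cup\to_Y)$. Then: (1) $\to_Y$ satisfies head factorization: $\to_Y^*\subseteq\to_{\mathsf hY}^*\cdot\to_{\neg\mathsf hY}^*$; (2) $\to_{\neg\mathsf h\beta}\cdot\mapsto_Y\ \subseteq\ \to_{\mathsf hY}\cdot\to_\beta^*$; (3) $\mapsto_Y$ is substitutive. Consequently $\to_\beta\cup\to_Y$ satisfies head factorization: $(\to_\beta\cup\to_Y)^*\subseteq(\to_{\mathsf h\beta}\cup\to_{\mathsf hY})^*\cdot(\to_{\neg\mathsf h\beta}\cup\to_{\neg\mathsf hY})^*$.
   Context: Terms of $\Lambda_Y$: $t::=x\mid Y\mid\lambda x.t\mid tt$ with $Y$ a constant, modulo $\alpha$-equivalence, with capture-avoiding substitution $t\{x:=q\}$. Contexts $C::=\langle\cdot\rangle\mid tC\mid Ct\mid\lambda x.C$; the contextual closure of a root relation $\mapsto_\rho$ is $C\langle r\rangle\to_\rho C\langle r'\rangle$ for $r\mapsto_\rho r'$. Rules: $(\lambda x.p)q\mapsto_\beta p\{x:=q\}$ and $Yp\mapsto_Y p(Yp)$. Head contexts: $H::=\lambda x_1\dots\lambda x_k.\langle\cdot\rangle t_1\dots t_n$ ($k,n\ge0$); non-head contexts are all other contexts. $\to_{\mathsf h\rho}$ / $\to_{\neg\mathsf h\rho}$ is the closure of $\mapsto_\rho$ under head / non-head contexts. A root relation $\mapsto$ is substitutive if $r\mapsto r'$ implies $r\{x:=q\}\mapsto r'\{x:=q\}$ for all $x,q$.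 $\to^*$ reflexive-transitive closure; $R\cdot S$ composition. -}

module Defs where

open import Data.Nat using (ℕ; zero; suc; _<ᵇ_; _≡ᵇ_; pred)
open import Data.Bool using (if_then_else_)
open import Data.Unit using (⊤)
open import Relation.Nullary using (¬_)
open import Relation.Binary.Core using (Rel)
open import Level using (0ℓ)

-- Terms of Λ_Y, with de Bruijn indices (so α-equivalence is syntactic equality).
data Term : Set where
  var : ℕ → Term
  Y   : Term
  lam : Term → Term
  app : Term → Term → Term

shift : ℕ → Term → Term
shift c (var n)   = if n <ᵇ c then var n else var (suc n)
shift c Y         = Y
shift c (lam t)   = lam (shift (suc c) t)
shift c (app t u) = app (shift c t) (shift c u)

-- capture-avoiding substitution t{k := q}: replace the free variable with
-- index k by q, and decrement the free indices above k (that variable disappears).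
sub : ℕ → Term → Term → Term
sub k q (var n)   = if n <ᵇ k then var n else (if n ≡ᵇ k then q else var (pred n))
sub k q Y         = Y
sub k q (lam t)   = lam (sub (suc k) (shift 0 q) t)
sub k q (app t u) = app (sub k q t) (sub k q u)

data _↦β_ : Rel Term 0ℓ where
  beta : ∀ p q → app (lam p) q ↦β sub 0 q p

data _↦Y_ : Rel Term 0ℓ where
  fix : ∀ p → app Y p ↦Y app p (app Y p)

data Ctx : Set where
  hole : Ctx
  appR : Term → Ctx → Ctx
  appL : Ctx → Term → Ctx
  lamC : Ctx → Ctx

plug : Ctx → Term → Term
plug hole       r = r
plug (appR t C) r = app t (plug C r)
plug (appL C t) r = app (plug C r) t
plug (lamC C)   r = lam (plug C r)

data Spine : Ctx → Set where
  sp-hole : Spine hole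
  sp-app  : ∀ {C} t → Spine C → Spine (appL C t)

data IsHead : Ctx → Set where
  hd-spine : ∀ {C} → Spine C → IsHead C
  hd-lam   : ∀ {C} → IsHead C → IsHead (lamC C)

data CtxClosure (P : Ctx → Set) (R : Rel Term 0ℓ) : Rel Term 0ℓ where
  ctx : ∀ {r r'} (C : Ctx) → P C → R r r' → CtxClosure P R (plug C r) (plug C r')

AnyCtx : Ctx → Set
AnyCtx _ = ⊤

NonHead : Ctx → Set
NonHead C = ¬ IsHead C

Full : Rel Term 0ℓ → Rel Term 0ℓ
Full = CtxClosure AnyCtx

Head : Rel Term 0ℓ → Rel Term 0ℓ
Head = CtxClosure IsHead

NHead : Rel Term 0ℓ → Rel Term 0ℓ
NHead = CtxClosure NonHead

Substitutive : Rel Term 0ℓ → Set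
Substitutive R = ∀ {r r'} → R r r' → ∀ (x : ℕ) (q : Term) → R (sub x q r) (sub x q r')

-- relational composition R · S (R first, then S)
open import Data.Product using (∃; _×_)
infixr 9 _·_
_·_ : Rel Term 0ℓ → Rel Term 0ℓ → Rel Term 0ℓ
(R · S) a c = ∃ λ b → R a b × S b c

module Submission where

-- Head factorisation is derived from a standardisation
-- relation in the style of Takahashi.  For an arbitrary root relation R let
-- WH R be its weak-head closure (closure under spines ⟨·⟩ t₁ … tₙ) and let
-- St R M N ("M standardises to N") mean: M weak-head reduces to a term with
-- the outermost constructor of N, whose immediate subterms standardise to
-- those of N.  St R is reflexive, contains WH R* on the left, and every St R
-- derivation splits into head steps followed by non-head steps.  The key
-- property is that St R absorbs one further step of Full R, which reduces
-- (by induction on the context) to absorbing a root step; we call this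
-- RootStandard R.  It holds for a Y-root step outright and for a β-root step
-- as soon as R is stable under shifting and substitution, which in turn rests
-- on the usual de Bruijn commutation lemmas proved first.

open import Defs
open import Data.Nat using (suc; _<ᵇ_; _≡ᵇ_; _<_; _≤_; z≤n; s≤s; _<?_)
open import Data.Nat.Properties
open import Data.Bool using (true; false; T)
open import Data.Unit using (tt)
open import Data.Empty using (⊥-elim)
open import Data.Sum using (inj₁; inj₂)
open import Data.Product using (_×_; _,_)
open import Function using (id)
open import Relation.Nullary using (yes; no; ¬_)
open import Relation.Binary.Core using (_⇒_; Rel)
open import Relation.Binary.Definitions using (tri<; tri≈; tri>)
open import Relation.Binary.PropositionalEquality
open import Relation.Binary.Construct.Closure.ReflexiveTransitive using (Star; ε; _◅_; _◅◅_; gmap) renaming (map to smap)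
open import Relation.Binary.Construct.Union using (_∪_)
open import Level using (0ℓ)

shift-var-below : ∀ {n c} → n < c → shift c (var n) ≡ var n
shift-var-below {n} {c} n<c with n <ᵇ c in eq
... | true  = refl
... | false = ⊥-elim (subst T eq (<⇒<ᵇ n<c))

shift-var-above : ∀ {n c} → c ≤ n → shift c (var n) ≡ var (suc n)
shift-var-above {n} {c} c≤n with n <ᵇ c in eq
... | true  = ⊥-elim (≤⇒≯ c≤n (<ᵇ⇒< n c (subst T (sym eq) _)))
... | false = refl

sub-var-below : ∀ {n k q} → n < k → sub k q (var n) ≡ var n
sub-var-below {n} {k} n<k with n <ᵇ k in eq
... | true  = refl
... | false = ⊥-elim (subst T eq (<⇒<ᵇ n<k))

sub-var-here : ∀ {k q} → sub k q (var k) ≡ q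
sub-var-here {k} with k <ᵇ k in eq
... | true = ⊥-elim (<-irrefl refl (<ᵇ⇒< k k (subst T (sym eq) _)))
... | false with k ≡ᵇ k in eq′
...   | true  = refl
...   | false = ⊥-elim (subst T eq′ (≡⇒≡ᵇ k k refl))

sub-var-above : ∀ {m k q} → k ≤ m → sub k q (var (suc m)) ≡ var m
sub-var-above {m} {k} k≤m with suc m <ᵇ k in eq
... | true = ⊥-elim (≤⇒≯ k≤m (<⇒≤ (<ᵇ⇒< (suc m) k (subst T (sym eq) _))))
... | false with suc m ≡ᵇ k in eq′
...   | true  = ⊥-elim (≤⇒≯ k≤m (subst (m <_) (≡ᵇ⇒≡ (suc m) k (subst T (sym eq′) _)) ≤-refl))
...   | false = refl

shift-shift : ∀ d c t → d ≤ c → shift (suc c) (shift d t) ≡ shift d (shift c t)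
shift-shift d c (var n) d≤c with n <? d
... | yes n<d
  rewrite shift-var-below n<d
        | shift-var-below {n} {suc c} (≤-trans n<d (≤-trans d≤c (n≤1+n c)))
        | shift-var-below (<-≤-trans n<d d≤c)
        | shift-var-below n<d = refl
... | no n≮d with n <? c
...   | yes n<c
  rewrite shift-var-above (≮⇒≥ n≮d)
        | shift-var-below {suc n} {suc c} (s≤s n<c)
        | shift-var-below n<c
        | shift-var-above (≮⇒≥ n≮d) = refl
...   | no n≮c
  rewrite shift-var-above (≮⇒≥ n≮d)
        | shift-var-above {suc n} {suc c} (s≤s (≮⇒≥ n≮c))
        | shift-var-above (≮⇒≥ n≮c)
        | shift-var-above {suc n} {d} (≤-trans (≮⇒≥ n≮d) (n≤1+n n)) = refl
shift-shift d c Y         _   = refl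
shift-shift d c (lam t)   d≤c = cong lam (shift-shift (suc d) (suc c) t (s≤s d≤c))
shift-shift d c (app t u) d≤c = cong₂ app (shift-shift d c t d≤c) (shift-shift d c u d≤c)

sub-shift : ∀ k q t → sub k q (shift k t) ≡ t
sub-shift k q (var n) with n <? k
... | yes n<k rewrite shift-var-below n<k = sub-var-below n<k
... | no n≮k  rewrite shift-var-above (≮⇒≥ n≮k) = sub-var-above (≮⇒≥ n≮k)
sub-shift k q Y         = refl
sub-shift k q (lam t)   = cong lam (sub-shift (suc k) (shift 0 q) t)
sub-shift k q (app t u) = cong₂ app (sub-shift k q t) (sub-shift k q u)

shift-sub-below : ∀ c k q t → c ≤ k → shift c (sub k q t) ≡ sub (suc k) (shift c q) (shift c t)
shift-sub-below c k q (var n) c≤k with <-cmp n k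
... | tri< n<k _ _ with n <? c
...   | yes n<c rewrite sub-var-below {q = q} n<k | shift-var-below n<c =
          sym (sub-var-below (≤-trans n<c (≤-trans c≤k (n≤1+n k))))
...   | no n≮c  rewrite sub-var-below {q = q} n<k | shift-var-above (≮⇒≥ n≮c) =
          sym (sub-var-below (s≤s n<k))
shift-sub-below c k q (var n) c≤k | tri≈ _ refl _
  rewrite sub-var-here {n} {q} | shift-var-above c≤k = sym (sub-var-here {suc n} {shift c q})
shift-sub-below c k q (var (suc m)) c≤k | tri> _ _ (s≤s k≤m)
  rewrite sub-var-above {q = q} k≤m
        | shift-var-above (≤-trans c≤k k≤m)
        | shift-var-above {suc m} {c} (≤-trans c≤k (≤-trans k≤m (n≤1+n m))) = sym (sub-var-above (s≤s k≤m))
shift-sub-below c k q Y _ = refl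
shift-sub-below c k q (lam t) c≤k = cong lam (begin
  shift (suc c) (sub (suc k) (shift 0 q) t)
    ≡⟨ shift-sub-below (suc c) (suc k) (shift 0 q) t (s≤s c≤k) ⟩
  sub (suc (suc k)) (shift (suc c) (shift 0 q)) (shift (suc c) t)
    ≡⟨ cong (λ z → sub (suc (suc k)) z (shift (suc c) t)) (shift-shift 0 c q z≤n) ⟩
  sub (suc (suc k)) (shift 0 (shift c q)) (shift (suc c) t) ∎)
  where open ≡-Reasoning
shift-sub-below c k q (app t u) c≤k = cong₂ app (shift-sub-below c k q t c≤k) (shift-sub-below c k q u c≤k)

shift-sub-above : ∀ c k q t → k ≤ c → shift c (sub k q t) ≡ sub k (shift c q) (shift (suc c) t)
shift-sub-above c k q (var n) k≤c with <-cmp n k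
... | tri< n<k _ _
  rewrite sub-var-below {q = q} n<k
        | shift-var-below (<-≤-trans n<k k≤c)
        | shift-var-below {n} {suc c} (<-≤-trans n<k (≤-trans k≤c (n≤1+n c))) = sym (sub-var-below n<k)
... | tri≈ _ refl _
  rewrite sub-var-here {n} {q} | shift-var-below {n} {suc c} (s≤s k≤c) = sym (sub-var-here {n} {shift c q})
shift-sub-above c k q (var (suc m)) k≤c | tri> _ _ (s≤s k≤m) with m <? c
... | yes m<c
  rewrite sub-var-above {q = q} k≤m | shift-var-below m<c | shift-var-below {suc m} {suc c} (s≤s m<c) =
    sym (sub-var-above k≤m)
... | no m≮c
  rewrite sub-var-above {q = q} k≤m | shift-var-above (≮⇒≥ m≮c) | shift-var-above {suc m} {suc c} (s≤s (≮⇒≥ m≮c)) =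
    sym (sub-var-above (≤-trans k≤m (n≤1+n m)))
shift-sub-above c k q Y _ = refl
shift-sub-above c k q (lam t) k≤c = cong lam (begin
  shift (suc c) (sub (suc k) (shift 0 q) t)
    ≡⟨ shift-sub-above (suc c) (suc k) (shift 0 q) t (s≤s k≤c) ⟩
  sub (suc k) (shift (suc c) (shift 0 q)) (shift (suc (suc c)) t)
    ≡⟨ cong (λ z → sub (suc k) z (shift (suc (suc c)) t)) (shift-shift 0 c q z≤n) ⟩
  sub (suc k) (shift 0 (shift c q)) (shift (suc (suc c)) t) ∎)
  where open ≡-Reasoning
shift-sub-above c k q (app t u) k≤c = cong₂ app (shift-sub-above c k q t k≤c) (shift-sub-above c k q u k≤c)

sub-sub : ∀ j k q b t → j ≤ k → sub k q (sub j b t) ≡ sub j (sub k q b) (sub (suc k) (shift j q) t)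
sub-sub j k q b (var n) j≤k with <-cmp n j
... | tri< n<j _ _
  rewrite sub-var-below {q = b} n<j
        | sub-var-below {q = q} (<-≤-trans n<j j≤k)
        | sub-var-below {q = shift j q} (<-≤-trans n<j (≤-trans j≤k (n≤1+n k))) = sym (sub-var-below n<j)
... | tri≈ _ refl _
  rewrite sub-var-here {n} {b} | sub-var-below {q = shift n q} (s≤s j≤k) = sym (sub-var-here {j} {sub k q b})
sub-sub j k q b (var (suc m)) j≤k | tri> _ _ (s≤s j≤m) with <-cmp m k
... | tri< m<k _ _
  rewrite sub-var-above {q = b} j≤m | sub-var-below {q = q} m<k | sub-var-below {q = shift j q} (s≤s m<k) =
    sym (sub-var-above j≤m)
... | tri≈ _ refl _
  rewrite sub-var-above {q = b} j≤m | sub-var-here {m} {q} | sub-var-here {suc m} {shift j q} =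
    sym (sub-shift j (sub m q b) q)
sub-sub j k q b (var (suc (suc l))) j≤k | tri> _ _ (s≤s j≤m) | tri> _ _ (s≤s k≤l)
  rewrite sub-var-above {q = b} j≤m | sub-var-above {q = q} k≤l | sub-var-above {q = shift j q} (s≤s k≤l) =
    sym (sub-var-above (≤-trans j≤k k≤l))
sub-sub j k q b Y _ = refl
sub-sub j k q b (lam t) j≤k = cong lam (begin
  sub (suc k) (shift 0 q) (sub (suc j) (shift 0 b) t)
    ≡⟨ sub-sub (suc j) (suc k) (shift 0 q) (shift 0 b) t (s≤s j≤k) ⟩
  sub (suc j) (sub (suc k) (shift 0 q) (shift 0 b)) (sub (suc (suc k)) (shift (suc j) (shift 0 q)) t)
    ≡⟨ cong₂ (λ z w → sub (suc j) z (sub (suc (suc k)) w t))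
             (sym (shift-sub-below 0 k q b z≤n)) (shift-shift 0 j q z≤n) ⟩
  sub (suc j) (shift 0 (sub k q b)) (sub (suc (suc k)) (shift 0 (shift j q)) t) ∎)
  where open ≡-Reasoning
sub-sub j k q b (app t u) j≤k = cong₂ app (sub-sub j k q b t j≤k) (sub-sub j k q b u j≤k)

ShiftStable : Rel Term 0ℓ → Set
ShiftStable R = ∀ {t u} → R t u → ∀ c → R (shift c t) (shift c u)

↦β-shift : ShiftStable _↦β_
↦β-shift (beta p q) c rewrite shift-sub-above c 0 q p z≤n = beta _ _

↦β-substitutive : Substitutive _↦β_
↦β-substitutive (beta p b) k q rewrite sub-sub 0 k q b p z≤n = beta _ _

↦Y-shift : ShiftStable _↦Y_
↦Y-shift (fix p) c = fix (shift c p)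

↦Y-substitutive : Substitutive _↦Y_
↦Y-substitutive (fix p) k q = fix (sub k q p)

∪-shift : ∀ {R S} → ShiftStable R → ShiftStable S → ShiftStable (R ∪ S)
∪-shift R-shift S-shift (inj₁ r) c = inj₁ (R-shift r c)
∪-shift R-shift S-shift (inj₂ s) c = inj₂ (S-shift s c)

∪-substitutive : ∀ {R S} → Substitutive R → Substitutive S → Substitutive (R ∪ S)
∪-substitutive R-sub S-sub (inj₁ r) k q = inj₁ (R-sub r k q)
∪-substitutive R-sub S-sub (inj₂ s) k q = inj₂ (S-sub s k q)

module Standardisation (R : Rel Term 0ℓ) where

  data WH : Rel Term 0ℓ where
    wh-root : ∀ {t u}   → R t u → WH t u
    wh-app  : ∀ {t t' u} → WH t t' → WH (app t u) (app t' u)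

  WH* : Rel Term 0ℓ
  WH* = Star WH

  data St : Rel Term 0ℓ where
    st-var : ∀ {M n}          → WH* M (var n) → St M (var n)
    st-Y   : ∀ {M}            → WH* M Y → St M Y
    st-lam : ∀ {M P P'}       → WH* M (lam P) → St P P' → St M (lam P')
    st-app : ∀ {M P P' Q Q'}  → WH* M (app P Q) → St P P' → St Q Q' → St M (app P' Q')

  wh*-app : ∀ {t t' u} → WH* t t' → WH* (app t u) (app t' u)
  wh*-app {u = u} = gmap (λ z → app z u) wh-app

  St-refl : ∀ M → St M M
  St-refl (var n)   = st-var ε
  St-refl Y         = st-Y ε
  St-refl (lam M)   = st-lam ε (St-refl M)
  St-refl (app M N) = st-app ε (St-refl M) (St-refl N)

  WH*-St : ∀ {M N P} → WH* M N → St N P → St M P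
  WH*-St h (st-var h')     = st-var (h ◅◅ h')
  WH*-St h (st-Y h')       = st-Y (h ◅◅ h')
  WH*-St h (st-lam h' s)   = st-lam (h ◅◅ h') s
  WH*-St h (st-app h' s t) = st-app (h ◅◅ h') s t

  -- St absorbs one root step at its end.  This is the one property of R on
  -- which the factorisation depends.
  RootStandard : Set
  RootStandard = ∀ {M r r'} → St M r → R r r' → St M r'

  -- A Y-root step is absorbed as soon as R contains ↦Y:
  -- M ⇒wh Y Q ⇒wh Q (Y Q), and Q standardises to p.
  Y-absorbed : (∀ {t u} → t ↦Y u → R t u) → ∀ {M p} → St M (app Y p) → St M (app p (app Y p))
  Y-absorbed ⊇Y (st-app h (st-Y hY) sQ) =
    WH*-St (h ◅◅ wh*-app hY ◅◅ wh-root (⊇Y (fix _)) ◅ ε) (st-app ε sQ (st-app ε (st-Y ε) sQ))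

  St-step : RootStandard → ∀ {M r r'} C → St M (plug C r) → R r r' → St M (plug C r')
  St-step root hole       s                r = root s r
  St-step root (appR t C) (st-app h s₁ s₂) r = st-app h s₁ (St-step root C s₂ r)
  St-step root (appL C t) (st-app h s₁ s₂) r = st-app h (St-step root C s₁ r) s₂
  St-step root (lamC C)   (st-lam h s)     r = st-lam h (St-step root C s r)

  Full*⇒St : RootStandard → ∀ {M N} → Star (Full R) M N → St M N
  Full*⇒St root {M} = go (St-refl M)
    where
    go : ∀ {N P} → St M N → Star (Full R) N P → St M P
    go s ε                  = s
    go s (ctx C _ r ◅ rest) = go (St-step root C s r) rest

  module Stable (R-shift : ShiftStable R) (R-sub : Substitutive R) where

    WH-shift : ∀ c {t u} → WH t u → WH (shift c t) (shift c u)
    WH-shift c (wh-root r) = wh-root (R-shift r c)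
    WH-shift c (wh-app w)  = wh-app (WH-shift c w)

    WH*-shift : ∀ c {t u} → WH* t u → WH* (shift c t) (shift c u)
    WH*-shift c = gmap (shift c) (WH-shift c)

    WH-sub : ∀ k q {t u} → WH t u → WH (sub k q t) (sub k q u)
    WH-sub k q (wh-root r) = wh-root (R-sub r k q)
    WH-sub k q (wh-app w)  = wh-app (WH-sub k q w)

    WH*-sub : ∀ k q {t u} → WH* t u → WH* (sub k q t) (sub k q u)
    WH*-sub k q = gmap (sub k q) (WH-sub k q)

    -- A shifted variable is still a variable, once the conditional reduces.
    St-shifted-var : ∀ {M} n c → WH* M (shift c (var n)) → St M (shift c (var n))
    St-shifted-var n c h with n <ᵇ c
    ... | true  = st-var h
    ... | false = st-var h

    St-shift : ∀ c {M N} → St M N → St (shift c M) (shift c N)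
    St-shift c (st-var {n = n} h) = St-shifted-var n c (WH*-shift c h)
    St-shift c (st-Y h)           = st-Y (WH*-shift c h)
    St-shift c (st-lam h s)       = st-lam (WH*-shift c h) (St-shift (suc c) s)
    St-shift c (st-app h s t)     = st-app (WH*-shift c h) (St-shift c s) (St-shift c t)

    -- Substituting into a variable yields a variable or the substituted term.
    St-substituted-var : ∀ {M q q'} n k → WH* M (sub k q (var n)) → St q q' → St M (sub k q' (var n))
    St-substituted-var n k h s with n <ᵇ k
    ... | true = st-var h
    ... | false with n ≡ᵇ k
    ...   | true  = WH*-St h s
    ...   | false = st-var h

    St-sub : ∀ k {M M' q q'} → St M M' → St q q' → St (sub k q M) (sub k q' M')
    St-sub k {q = q} (st-var {n = n} h) sq = St-substituted-var n k (WH*-sub k q h) sq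
    St-sub k {q = q} (st-Y h)       sq = st-Y (WH*-sub k q h)
    St-sub k {q = q} (st-lam h s)   sq = st-lam (WH*-sub k q h) (St-sub (suc k) s (St-shift 0 sq))
    St-sub k {q = q} (st-app h s t) sq = st-app (WH*-sub k q h) (St-sub k s sq) (St-sub k t sq)

    -- A β-root step is absorbed as soon as R contains ↦β:
    -- M ⇒wh (λ.P) Q ⇒wh P{0:=Q}, and P{0:=Q} standardises to p{0:=q}.
    β-absorbed : (∀ {t u} → t ↦β u → R t u) → ∀ {M p q} → St M (app (lam p) q) → St M (sub 0 q p)
    β-absorbed ⊇β (st-app h (st-lam hλ sP) sQ) =
      WH*-St (h ◅◅ wh*-app hλ ◅◅ wh-root (⊇β (beta _ _)) ◅ ε) (St-sub 0 sP sQ)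

  WH⇒Full : ∀ {t u} → WH t u → Full R t u
  WH⇒Full (wh-root r) = ctx hole tt r
  WH⇒Full (wh-app {u = u} w) with WH⇒Full w
  ... | ctx C _ r = ctx (appL C u) tt r

  lam-Full : ∀ {t u} → Full R t u → Full R (lam t) (lam u)
  lam-Full (ctx C _ r) = ctx (lamC C) tt r

  appL-Full : ∀ {v t u} → Full R t u → Full R (app t v) (app u v)
  appL-Full {v} (ctx C _ r) = ctx (appL C v) tt r

  appR-Full : ∀ {v t u} → Full R t u → Full R (app v t) (app v u)
  appR-Full {v} (ctx C _ r) = ctx (appR v C) tt r

  St⇒Full* : ∀ {M N} → St M N → Star (Full R) M N
  St⇒Full* (st-var h)     = smap WH⇒Full h
  St⇒Full* (st-Y h)       = smap WH⇒Full h
  St⇒Full* (st-lam h s)   = smap WH⇒Full h ◅◅ gmap lam lam-Full (St⇒Full* s)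
  St⇒Full* (st-app h s t) =
    smap WH⇒Full h ◅◅ gmap (λ z → app z _) appL-Full (St⇒Full* s) ◅◅ gmap (app _) appR-Full (St⇒Full* t)

  -- Spine steps and non-spine steps: the factorisation of the function part
  -- of an application, where no λ may be entered.
  SpineStep NonSpineStep : Rel Term 0ℓ
  SpineStep    = CtxClosure Spine R
  NonSpineStep = CtxClosure (λ C → ¬ Spine C) R

  WH⇒SpineStep : ∀ {t u} → WH t u → SpineStep t u
  WH⇒SpineStep (wh-root r) = ctx hole sp-hole r
  WH⇒SpineStep (wh-app {u = u} w) with WH⇒SpineStep w
  ... | ctx C s r = ctx (appL C u) (sp-app u s) r

  SpineStep⇒Head : ∀ {t u} → SpineStep t u → Head R t u
  SpineStep⇒Head (ctx C s r) = ctx C (hd-spine s) r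

  WH⇒Head : ∀ {t u} → WH t u → Head R t u
  WH⇒Head w = SpineStep⇒Head (WH⇒SpineStep w)

  appL-SpineStep : ∀ {v t u} → SpineStep t u → SpineStep (app t v) (app u v)
  appL-SpineStep {v} (ctx C s r) = ctx (appL C v) (sp-app v s) r

  appL-NonSpineStep : ∀ {v t u} → NonSpineStep t u → NonSpineStep (app t v) (app u v)
  appL-NonSpineStep {v} (ctx C ns r) = ctx (appL C v) (λ { (sp-app _ s) → ns s }) r

  appR-NonSpineStep : ∀ {v t u} → Full R t u → NonSpineStep (app v t) (app v u)
  appR-NonSpineStep {v} (ctx C _ r) = ctx (appR v C) (λ ()) r

  lam-NonSpineStep : ∀ {t u} → Full R t u → NonSpineStep (lam t) (lam u)
  lam-NonSpineStep (ctx C _ r) = ctx (lamC C) (λ ()) r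

  spine-factorisation : ∀ {M N} → St M N → (Star SpineStep · Star NonSpineStep) M N
  spine-factorisation (st-var h)     = _ , smap WH⇒SpineStep h , ε
  spine-factorisation (st-Y h)       = _ , smap WH⇒SpineStep h , ε
  spine-factorisation (st-lam h s)   = _ , smap WH⇒SpineStep h , gmap lam lam-NonSpineStep (St⇒Full* s)
  spine-factorisation (st-app h s t) with spine-factorisation s
  ... | _ , spine , nonSpine =
    _ , smap WH⇒SpineStep h ◅◅ gmap (λ z → app z _) appL-SpineStep spine
      , gmap (λ z → app z _) appL-NonSpineStep nonSpine ◅◅ gmap (app _) appR-NonSpineStep (St⇒Full* t)

  lam-Head : ∀ {t u} → Head R t u → Head R (lam t) (lam u)
  lam-Head (ctx C h r) = ctx (lamC C) (hd-lam h) r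

  lam-NHead : ∀ {t u} → NHead R t u → NHead R (lam t) (lam u)
  lam-NHead (ctx C nh r) = ctx (lamC C) (λ { (hd-spine ()) ; (hd-lam h) → nh h }) r

  appL-NHead : ∀ {v t u} → NonSpineStep t u → NHead R (app t v) (app u v)
  appL-NHead {v} (ctx C ns r) = ctx (appL C v) (λ { (hd-spine (sp-app _ s)) → ns s }) r

  appR-NHead : ∀ {v t u} → Full R t u → NHead R (app v t) (app v u)
  appR-NHead {v} (ctx C _ r) = ctx (appR v C) (λ { (hd-spine ()) }) r

  -- Every standard reduction is head steps followed by non-head steps:
  -- under a λ the head part continues, in an application it is the spine
  -- part of the function.
  St-head-factorisation : ∀ {M N} → St M N → (Star (Head R) · Star (NHead R)) M N
  St-head-factorisation (st-var h) = _ , smap WH⇒Head h , ε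
  St-head-factorisation (st-Y h)   = _ , smap WH⇒Head h , ε
  St-head-factorisation (st-lam h s) with St-head-factorisation s
  ... | _ , heads , nonHeads =
    _ , smap WH⇒Head h ◅◅ gmap lam lam-Head heads , gmap lam lam-NHead nonHeads
  St-head-factorisation (st-app h s t) with spine-factorisation s
  ... | _ , spine , nonSpine =
    _ , smap SpineStep⇒Head (smap WH⇒SpineStep h ◅◅ gmap (λ z → app z _) appL-SpineStep spine)
      , gmap (λ z → app z _) appL-NHead nonSpine ◅◅ gmap (app _) appR-NHead (St⇒Full* t)

  head-factorisation : RootStandard → Star (Full R) ⇒ (Star (Head R) · Star (NHead R))
  head-factorisation root steps = St-head-factorisation (Full*⇒St root steps)

Y-rootStandard : Standardisation.RootStandard _↦Y_
Y-rootStandard s (fix p) = Standardisation.Y-absorbed _↦Y_ id s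

βY-rootStandard : Standardisation.RootStandard (_↦β_ ∪ _↦Y_)
βY-rootStandard s (inj₁ (beta p q)) = β-absorbed inj₁ s
  where open Standardisation.Stable (_↦β_ ∪ _↦Y_)
               (∪-shift {_↦β_} {_↦Y_} ↦β-shift ↦Y-shift)
               (∪-substitutive {_↦β_} {_↦Y_} ↦β-substitutive ↦Y-substitutive)
βY-rootStandard s (inj₂ (fix p))    = Standardisation.Y-absorbed (_↦β_ ∪ _↦Y_) inj₂ s

Full-∪ : ∀ {R S} → (Full R ∪ Full S) ⇒ Full (R ∪ S)
Full-∪ (inj₁ (ctx C _ r)) = ctx C tt (inj₁ r)
Full-∪ (inj₂ (ctx C _ s)) = ctx C tt (inj₂ s)

CtxClosure-∪ : ∀ {P R S} → CtxClosure P (R ∪ S) ⇒ (CtxClosure P R ∪ CtxClosure P S)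
CtxClosure-∪ (ctx C p (inj₁ r)) = inj₁ (ctx C p r)
CtxClosure-∪ (ctx C p (inj₂ s)) = inj₂ (ctx C p s)

-- Part (2): a Y-redex at the root created by a non-head β-step must be
-- Y p with the β-step inside p; performing the Y-step first duplicates
-- that β-redex, which is then reduced in both copies.
nonHeadβ-rootY-swap : (NHead _↦β_ · _↦Y_) ⇒ (Head _↦Y_ · Star (Full _↦β_))
nonHeadβ-rootY-swap (_ , ctx hole nh _ , _)             = ⊥-elim (nh (hd-spine sp-hole))
nonHeadβ-rootY-swap (_ , ctx (appL hole t) nh _ , _)    = ⊥-elim (nh (hd-spine (sp-app t sp-hole)))
nonHeadβ-rootY-swap (_ , ctx (appL (appL C _) _) _ _ , ())
nonHeadβ-rootY-swap (_ , ctx (appL (appR _ C) _) _ _ , ())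
nonHeadβ-rootY-swap (_ , ctx (appL (lamC C) _) _ _ , ())
nonHeadβ-rootY-swap (_ , ctx (lamC C) _ _ , ())
nonHeadβ-rootY-swap (_ , ctx (appR .Y C) _ (beta p q) , fix _) =
  _ , ctx hole (hd-spine sp-hole) (fix _)
    , ctx (appL C _) tt (beta p q) ◅ ctx (appR _ (appR Y C)) tt (beta p q) ◅ ε

proposition8p1 : (Star (Full _↦Y_) ⇒ (Star (Head _↦Y_) · Star (NHead _↦Y_)))
    × ((NHead _↦β_ · _↦Y_) ⇒ (Head _↦Y_ · Star (Full _↦β_)))
    × Substitutive _↦Y_
    × (Star (Full _↦β_ ∪ Full _↦Y_)
    ⇒ (Star (Head _↦β_ ∪ Head _↦Y_) · Star (NHead _↦β_ ∪ NHead _↦Y_)))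
proposition8p1 =
    Standardisation.head-factorisation _↦Y_ Y-rootStandard
  , nonHeadβ-rootY-swap
  , ↦Y-substitutive
  , βY-factorisation
  where
  βY-factorisation : Star (Full _↦β_ ∪ Full _↦Y_)
                     ⇒ (Star (Head _↦β_ ∪ Head _↦Y_) · Star (NHead _↦β_ ∪ NHead _↦Y_))
  βY-factorisation steps
    with Standardisation.head-factorisation (_↦β_ ∪ _↦Y_) βY-rootStandard (smap Full-∪ steps)
  ... | _ , heads , nonHeads = _ , smap CtxClosure-∪ heads , smap CtxClosure-∪ nonHeads
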